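{- Let $G^{w}$ be a connected dual number weighted graph on $n$ vertices, and partition its Laplacian matrix as $L_{w}=\begin{bmatrix}\widetilde{L}_{11}&\widetilde{L}_{12}\\ \widetilde{L}_{12}^{T}&\widetilde{L}_{22}\end{bmatrix}$ with $\widetilde{L}_{11}\in\mathbb{D}^{(n-1)\times(n-1)}$. Then $\widetilde{L}_{11}$ is invertible, $\begin{bmatrix}\widetilde{L}_{11}^{ -1}&0\\0&0\end{bmatrix}$ is a $\{1\}$-inverse of $L_{w}$, and the set of all $\{1\}$-inverses of $L_{w}$ is $$\left\{\begin{bmatrix}\widetilde{L}_{11}^{ -1}&0\\0&0\end{bmatrix}+\begin{bmatrix}0&\mathbf{1}\\0&1\end{bmatrix}P+Q\begin{bmatrix}0&0\\ \mathbf{1}^{T}&1\end{bmatrix}: P,Q\in\mathbb{D}^{n\times n}\right\},$$ where $\mathbf{1}$ is the all-ones vector of length $n-1$.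
   Context: Dual numbers: $\mathbb{D}=\{a_s+a_d\varepsilon: a_s,a_d\in\mathbb{R}\}$ with $\varepsilon\neq 0$, $\varepsilon^2=0$. For $A\in\mathbb{D}^{m\times n}$, a $\{1\}$-inverse is any $X\in\mathbb{D}^{n\times m}$ with $AXA=A$; a square dual matrix $A$ is invertible if some $B$ satisfies $AB=BA=I$. Dual number weighted graph: given a graph $G=(V,E)$ with $V=[n]$ and reals $\widehat{a}_e$ ($e\in E$), each edge $e$ gets weight $w(e)=1+\widehat{a}_e\varepsilon$. Its adjacency matrix $A_w$ has $(i,j)$ entry $1+\widehat{a}_{e}\varepsilon$ if $e=\{i,j\}\in E$ and $0$ otherwise; its degree matrix $D_w$ is diagonal with $i$-th entry $\sum_j (A_w)_{ij}$; its Laplacian matrix is $L_w=D_w-A_w$. $G^w$ is connected if $G$ is. -}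

module Defs where

open import Level using (0ℓ)
open import Data.Bool using (Bool; true; false; if_then_else_)
open import Data.Fin using (Fin; zero; suc)
open import Data.Nat using (ℕ; zero; suc)
open import Data.Sum using (_⊎_; inj₁; inj₂)
open import Data.Unit using (⊤; tt)
open import Data.Product using (Σ; _×_; _,_; ∃; ∃-syntax)
open import Relation.Binary.PropositionalEquality using (_≡_; _≢_)
open import Relation.Binary.Structures using (IsTotalOrder)
open import Algebra.Structures using (IsCommutativeRing)
open import Relation.Nullary using (¬_)

record RealField : Set₁ where
  field
    ℝ     : Set
    _+_   : ℝ → ℝ → ℝ
    _*_   : ℝ → ℝ → ℝ
    -_    : ℝ → ℝ
    0r    : ℝ
    1r    : ℝ
    _⁻¹   : (x : ℝ) → x ≢ 0r → ℝ
    _≤_   : ℝ → ℝ → Set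
    isCommutativeRing : IsCommutativeRing _≡_ _+_ _*_ -_ 0r 1r
    0≢1   : 0r ≢ 1r
    inverseʳ : (x : ℝ) (p : x ≢ 0r) → (x * (x ⁻¹) p) ≡ 1r
    isTotalOrder : IsTotalOrder _≡_ _≤_
    +-mono-≤ : ∀ {x y} z → x ≤ y → (x + z) ≤ (y + z)
    *-nonneg : ∀ {x y} → 0r ≤ x → 0r ≤ y → 0r ≤ (x * y)
    complete : (P : ℝ → Set) → ∃ P → (∃[ b ] (∀ x → P x → x ≤ b)) →
               ∃[ s ] ((∀ x → P x → x ≤ s) × (∀ b → (∀ x → P x → x ≤ b) → s ≤ b))

module Theory (RF : RealField) where
  open RealField RF

  -- Dual numbers a_s + a_d ε with ε² = 0

  record 𝔻 : Set where
    constructor _+_ε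
    field
      st : ℝ
      du : ℝ
  open 𝔻 public

  _⊕_ : 𝔻 → 𝔻 → 𝔻
  (a + b ε) ⊕ (c + d ε) = (a + c) + (b + d) ε

  _⊗_ : 𝔻 → 𝔻 → 𝔻
  (a + b ε) ⊗ (c + d ε) = (a * c) + ((a * d) + (b * c)) ε

  ⊖_ : 𝔻 → 𝔻
  ⊖ (a + b ε) = (- a) + (- b) ε

  0d 1d : 𝔻
  0d = 0r + 0r ε
  1d = 1r + 0r ε

  Mat : ℕ → ℕ → Set
  Mat m n = Fin m → Fin n → 𝔻

  sumFin : ∀ {n} → (Fin n → 𝔻) → 𝔻
  sumFin {zero}  f = 0d
  sumFin {suc n} f = f zero ⊕ sumFin (λ i → f (suc i))

  _·_ : ∀ {m k n} → Mat m k → Mat k n → Mat m n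
  (A · B) i j = sumFin (λ l → A i l ⊗ B l j)

  _⊞_ : ∀ {m n} → Mat m n → Mat m n → Mat m n
  (A ⊞ B) i j = A i j ⊕ B i j

  _≈_ : ∀ {m n} → Mat m n → Mat m n → Set
  A ≈ B = ∀ i j → A i j ≡ B i j

  I : ∀ {n} → Mat n n
  I i j with i Data.Fin.≟ j
  ... | Relation.Nullary.yes _ = 1d
  ... | Relation.Nullary.no  _ = 0d

  IsInverse : ∀ {n} → Mat n n → Mat n n → Set
  IsInverse A B = ((A · B) ≈ I) × ((B · A) ≈ I)

  Invertible : ∀ {n} → Mat n n → Set
  Invertible A = ∃[ B ] IsInverse A B

  IsOneInverse : ∀ {m n} → Mat m n → Mat n m → Set
  IsOneInverse A X = ((A · X) · A) ≈ A

  -- Block structure of an n×n matrix with n = suc m: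
  -- the first m indices (inj₁) and the last index (inj₂)

  view : ∀ {m} → Fin (suc m) → Fin m ⊎ ⊤
  view {zero}  zero    = inj₂ tt
  view {suc m} zero    = inj₁ zero
  view {suc m} (suc i) with view {m} i
  ... | inj₁ k = inj₁ (suc k)
  ... | inj₂ t = inj₂ t

  block11 : ∀ {m} → Mat (suc m) (suc m) → Mat m m
  block11 L i j = L (Data.Fin.inject₁ i) (Data.Fin.inject₁ j)

  padZero : ∀ {m} → Mat m m → Mat (suc m) (suc m)
  padZero A i j with view i | view j
  ... | inj₁ a | inj₁ b = A a b
  ... | _      | _      = 0d

  lastColOnes : ∀ {m} → Mat (suc m) (suc m)
  lastColOnes i j with view j
  ... | inj₁ _ = 0d
  ... | inj₂ _ = 1d

  lastRowOnes : ∀ {m} → Mat (suc m) (suc m)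
  lastRowOnes i j with view i
  ... | inj₁ _ = 0d
  ... | inj₂ _ = 1d

  record Graph (n : ℕ) : Set where
    field
      Adj      : Fin n → Fin n → Bool
      Adj-sym  : ∀ i j → Adj i j ≡ Adj j i
      Adj-irr  : ∀ i → Adj i i ≡ false

  open Graph public

  data Reachable {n} (G : Graph n) : Fin n → Fin n → Set where
    here : ∀ {i} → Reachable G i i
    step : ∀ {i j k} → Adj G i j ≡ true → Reachable G j k → Reachable G i k

  Connected : ∀ {n} → Graph n → Set
  Connected G = ∀ i j → Reachable G i j

  record EdgeData {n} (G : Graph n) : Set where
    field
      â     : Fin n → Fin n → ℝ
      â-sym : ∀ i j → â i j ≡ â j i
  open EdgeData public

  -- adjacency, degree and Laplacian matrices of G^w, w(e) = 1 + â_e ε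
  adjacency : ∀ {n} (G : Graph n) → EdgeData G → Mat n n
  adjacency G a i j = if Adj G i j then (1r + â a i j ε) else 0d

  degree : ∀ {n} (G : Graph n) → EdgeData G → Mat n n
  degree G a i j with i Data.Fin.≟ j
  ... | Relation.Nullary.yes _ = sumFin (λ k → adjacency G a i k)
  ... | Relation.Nullary.no  _ = 0d

  laplacian : ∀ {n} (G : Graph n) → EdgeData G → Mat n n
  laplacian G a i j = degree G a i j ⊕ (⊖ adjacency G a i j)

module Submission where

-- Over the dual numbers an element is a unit as soon as its standard part is
-- nonzero.  The standard part of L̃₁₁ has an anisotropic quadratic form, since
-- 2 xᵀLx = Σ -Lᵢⱼ (xᵢ - xⱼ)² vanishes only for x constant on the connected
-- graph, i.e. for x = 0 once its last coordinate is 0.  Gaussian elimination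
-- therefore inverts L̃₁₁: every pivot has nonzero standard part and every
-- Schur complement is again anisotropic.
-- With G = [L̃₁₁⁻¹ 0; 0 0], E = [0 𝟏; 0 1] and F = [0 0; 𝟏ᵀ 1], the zero row
-- and column sums of L give LE = 0, FL = 0, GF = 0, GL + E = 1, LG + F = 1,
-- and in any ring these identities alone force LGL = L and make the solutions
-- of LXL = L exactly X = G + EY + ZF.

open import Defs
open import Level using (0ℓ)
open import Algebra.Bundles using (CommutativeRing; Ring; RawRing)
open import Algebra.Core using (Op₁; Op₂)
open import Algebra.Structures using (IsCommutativeRing)
open import Algebra.Solver.Ring.AlmostCommutativeRing using (fromCommutativeRing; _-Raw-AlmostCommutative⟶_)
import Algebra.Construct.Pointwise as Pointwise
open import Data.Bool using (true; false)
open import Data.Fin as Fin using (Fin; zero; suc; punchIn)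
open import Data.Fin.Properties as Finₚ using (punchInᵢ≢i)
import Data.Fin.Relation.Unary.Top as Top
open Top using (‵fromℕ; ‵inject₁)
open import Data.Maybe using (just; nothing)
open import Data.Nat as ℕ using (ℕ; zero; suc)
open import Data.Product using (_×_; _,_; ∃; ∃₂; ∃-syntax; proj₁; proj₂)
open import Data.Product.Properties using (≡-dec)
open import Data.Sum using (inj₁; inj₂; [_,_]′)
open import Data.Unit using (tt)
open import Data.Vec.Functional using (_∷_)
open import Function using (_∘_)
open import Function.Bundles using (_⇔_; mk⇔; Equivalence)
open import Relation.Binary.Definitions using (WeaklyDecidable)
open import Relation.Binary.PropositionalEquality as ≡ using (_≡_; _≢_)
open import Relation.Binary.Structures using (IsTotalOrder)
open import Relation.Nullary using (¬_; Dec; yes; no; contradiction)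

-- The ring solver with integer coefficients: it only has to decide equality
-- of integers, never of elements of R.
module IntegerCoefficientSolver (R : CommutativeRing 0ℓ 0ℓ) where

  open CommutativeRing R hiding (zero)
  open import Algebra.Properties.Ring ring
    using (-‿involutive; -‿+-comm; -0#≈0#; ⁻¹-anti-homo‿-; x[y-z]≈xy-xz; [y-z]x≈yx-zx)
  open import Algebra.Properties.CommutativeSemigroup +-commutativeSemigroup using (interchange)
  open import Algebra.Properties.Semiring.Mult.TCOptimised semiring using (1+×; ×-homo-+; ×1-homo-*) renaming (_×_ to _×′_)
  open import Relation.Binary.Reasoning.Setoid setoid

  -- The integer p - n, kept normalised (p or n is zero) so that equal
  -- integers are equal pairs.
  Difference : Set
  Difference = ℕ × ℕ

  normalise : ℕ → ℕ → Difference
  normalise zero    n       = 0 , n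
  normalise (suc p) zero    = suc p , 0
  normalise (suc p) (suc n) = normalise p n

  _+ᶻ_ _*ᶻ_ : Difference → Difference → Difference
  (p , n) +ᶻ (p′ , n′) = normalise (p ℕ.+ p′) (n ℕ.+ n′)
  (p , n) *ᶻ (p′ , n′) = normalise (p ℕ.* p′ ℕ.+ n ℕ.* n′) (p ℕ.* n′ ℕ.+ n ℕ.* p′)

  -ᶻ_ : Difference → Difference
  -ᶻ (p , n) = n , p

  integers : RawRing 0ℓ 0ℓ
  integers = record
    { Carrier = Difference ; _≈_ = _≡_
    ; _+_ = _+ᶻ_ ; _*_ = _*ᶻ_ ; -_ = -ᶻ_ ; 0# = 0 , 0 ; 1# = 1 , 0 }

  -- The case split makes 0 and 1 denote 0# and 1# on the nose, so that
  -- these constants in a goal match `:0` and `:1`.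
  ⟦_⟧ : Difference → Carrier
  ⟦ p     , zero  ⟧ = p ×′ 1#
  ⟦ zero  , suc n ⟧ = - (suc n ×′ 1#)
  ⟦ suc p , suc n ⟧ = ⟦ p , n ⟧

  -‿+-interchange : ∀ x x′ y y′ → (x + x′) - (y + y′) ≈ (x - y) + (x′ - y′)
  -‿+-interchange x x′ y y′ = trans (+-congˡ (sym (-‿+-comm y y′))) (interchange x x′ (- y) (- y′))

  -‿*-interchange : ∀ x y x′ y′ → (x * x′ + y * y′) - (x * y′ + y * x′) ≈ (x - y) * (x′ - y′)
  -‿*-interchange x y x′ y′ = begin
    (x * x′ + y * y′) - (x * y′ + y * x′)  ≈⟨ -‿+-interchange _ _ _ _ ⟩
    (x * x′ - x * y′) + (y * y′ - y * x′)  ≈⟨ +-congˡ (⁻¹-anti-homo‿- (y * x′) (y * y′)) ⟨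
    (x * x′ - x * y′) - (y * x′ - y * y′)  ≈⟨ +-cong (x[y-z]≈xy-xz x x′ y′) (-‿cong (x[y-z]≈xy-xz y x′ y′)) ⟨
    x * (x′ - y′) - y * (x′ - y′)          ≈⟨ [y-z]x≈yx-zx (x′ - y′) x y ⟨
    (x - y) * (x′ - y′)                    ∎

  ⟦⟧-difference : ∀ p n → ⟦ p , n ⟧ ≈ p ×′ 1# - n ×′ 1#
  ⟦⟧-difference p       zero    = sym (trans (+-congˡ -0#≈0#) (+-identityʳ _))
  ⟦⟧-difference zero    (suc n) = sym (+-identityˡ _)
  ⟦⟧-difference (suc p) (suc n) = begin
    ⟦ p , n ⟧                              ≈⟨ ⟦⟧-difference p n ⟩
    P - N                                  ≈⟨ +-identityˡ _ ⟨
    0# + (P - N)                           ≈⟨ +-congʳ (-‿inverseʳ 1#) ⟨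
    (1# - 1#) + (P - N)                    ≈⟨ -‿+-interchange 1# P 1# N ⟨
    (1# + P) - (1# + N)                    ≈⟨ +-cong (1+× p 1#) (-‿cong (1+× n 1#)) ⟨
    suc p ×′ 1# - suc n ×′ 1#              ∎
    where P = p ×′ 1#; N = n ×′ 1#

  ⟦normalise⟧ : ∀ p n → ⟦ normalise p n ⟧ ≈ p ×′ 1# - n ×′ 1#
  ⟦normalise⟧ p n = trans (⟦⟧-normalise p n) (⟦⟧-difference p n)
    where
    ⟦⟧-normalise : ∀ p n → ⟦ normalise p n ⟧ ≈ ⟦ p , n ⟧
    ⟦⟧-normalise zero    n       = refl
    ⟦⟧-normalise (suc p) zero    = refl
    ⟦⟧-normalise (suc p) (suc n) = ⟦⟧-normalise p n

  homomorphism : integers -Raw-AlmostCommutative⟶ fromCommutativeRing R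
  homomorphism = record
    { ⟦_⟧    = ⟦_⟧
    ; +-homo = +-homo
    ; *-homo = *-homo
    ; -‿homo = -‿homo
    ; 0-homo = refl
    ; 1-homo = refl
    }
    where
    -‿homo : ∀ x → ⟦ -ᶻ x ⟧ ≈ - ⟦ x ⟧
    -‿homo (p , n) = begin
      ⟦ n , p ⟧      ≈⟨ ⟦⟧-difference n p ⟩
      N - P          ≈⟨ +-comm N (- P) ⟩
      - P + N        ≈⟨ +-congˡ (-‿involutive N) ⟨
      - P - - N      ≈⟨ -‿+-comm P (- N) ⟩
      - (P - N)      ≈⟨ -‿cong (⟦⟧-difference p n) ⟨
      - ⟦ p , n ⟧    ∎
      where P = p ×′ 1#; N = n ×′ 1#
    +-homo : ∀ x y → ⟦ x +ᶻ y ⟧ ≈ ⟦ x ⟧ + ⟦ y ⟧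
    +-homo (p , n) (p′ , n′) = begin
      ⟦ normalise (p ℕ.+ p′) (n ℕ.+ n′) ⟧           ≈⟨ ⟦normalise⟧ (p ℕ.+ p′) (n ℕ.+ n′) ⟩
      (p ℕ.+ p′) ×′ 1# - (n ℕ.+ n′) ×′ 1#          ≈⟨ +-cong (×-homo-+ 1# p p′) (-‿cong (×-homo-+ 1# n n′)) ⟩
      (p ×′ 1# + p′ ×′ 1#) - (n ×′ 1# + n′ ×′ 1#)  ≈⟨ -‿+-interchange _ _ _ _ ⟩
      (p ×′ 1# - n ×′ 1#) + (p′ ×′ 1# - n′ ×′ 1#)  ≈⟨ +-cong (⟦⟧-difference p n) (⟦⟧-difference p′ n′) ⟨
      ⟦ p , n ⟧ + ⟦ p′ , n′ ⟧                       ∎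
    *-homo : ∀ x y → ⟦ x *ᶻ y ⟧ ≈ ⟦ x ⟧ * ⟦ y ⟧
    *-homo (p , n) (p′ , n′) = begin
      ⟦ normalise (p ℕ.* p′ ℕ.+ n ℕ.* n′) (p ℕ.* n′ ℕ.+ n ℕ.* p′) ⟧
        ≈⟨ ⟦normalise⟧ (p ℕ.* p′ ℕ.+ n ℕ.* n′) (p ℕ.* n′ ℕ.+ n ℕ.* p′) ⟩
      (p ℕ.* p′ ℕ.+ n ℕ.* n′) ×′ 1# - (p ℕ.* n′ ℕ.+ n ℕ.* p′) ×′ 1#
        ≈⟨ +-cong (×1-homo-*+* p p′ n n′) (-‿cong (×1-homo-*+* p n′ n p′)) ⟩
      (P * P′ + N * N′) - (P * N′ + N * P′)
        ≈⟨ -‿*-interchange P N P′ N′ ⟩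
      (P - N) * (P′ - N′)
        ≈⟨ *-cong (⟦⟧-difference p n) (⟦⟧-difference p′ n′) ⟨
      ⟦ p , n ⟧ * ⟦ p′ , n′ ⟧ ∎
      where
      P = p ×′ 1#; N = n ×′ 1#; P′ = p′ ×′ 1#; N′ = n′ ×′ 1#
      ×1-homo-*+* : ∀ a b c d → (a ℕ.* b ℕ.+ c ℕ.* d) ×′ 1# ≈ a ×′ 1# * b ×′ 1# + c ×′ 1# * d ×′ 1#
      ×1-homo-*+* a b c d = trans (×-homo-+ 1# (a ℕ.* b) (c ℕ.* d)) (+-cong (×1-homo-* a b) (×1-homo-* c d))

  _≟ᶻ_ : WeaklyDecidable (λ x y → ⟦ x ⟧ ≈ ⟦ y ⟧)
  x ≟ᶻ y with ≡-dec ℕ._≟_ ℕ._≟_ x y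
  ... | yes ≡.refl = just refl
  ... | no  _      = nothing

  open import Algebra.Solver.Ring integers (fromCommutativeRing R) homomorphism _≟ᶻ_ public
    using (Polynomial; solve; _:=_; _:+_; _:*_; _:-_; :-_; con)

  :0 :1 : ∀ {n} → Polynomial n
  :0 = con (0 , 0)
  :1 = con (1 , 0)

module Matrices {A : Set} {plus times : Op₂ A} {negate : Op₁ A} {0# 1# : A}
                (isCommutativeRing : IsCommutativeRing _≡_ plus times negate 0# 1#) where

  commutativeRing : CommutativeRing 0ℓ 0ℓ
  commutativeRing = record { isCommutativeRing = isCommutativeRing }

  open CommutativeRing commutativeRing
    using (_+_; _*_; -_; _-_; +-isAbelianGroup; +-identityˡ; +-identityʳ; -‿inverseˡ;
           *-assoc; *-comm; *-identityˡ; *-identityʳ; zeroˡ; zeroʳ; distribˡ; distribʳ; semiring; ring)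
  open import Algebra.Properties.Semiring.Sum semiring public
    using (sum; sum-cong-≗; sum-replicate-zero; sum-remove; sum-init-last; ∑-distrib-+; ∑-comm;
           *-distribˡ-sum; *-distribʳ-sum)
  open import Algebra.Properties.Ring ring using (-1*x≈-x; -‿distribʳ-*; x[y-z]≈xy-xz)
  open IntegerCoefficientSolver commutativeRing
  open ≡.≡-Reasoning

  sum-zero : ∀ {n} (f : Fin n → A) → (∀ i → f i ≡ 0#) → sum f ≡ 0#
  sum-zero {n} f f≗0 = ≡.trans (sum-cong-≗ f≗0) (sum-replicate-zero n)

  sum-single : ∀ {n} (f : Fin n → A) i → (∀ j → j ≢ i → f j ≡ 0#) → sum f ≡ f i
  sum-single {suc n} f i others = begin
    sum f                         ≡⟨ sum-remove {i = i} f ⟩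
    f i + sum (f ∘ punchIn i)     ≡⟨ ≡.cong (f i +_) (sum-zero _ (λ j → others _ (punchInᵢ≢i i j))) ⟩
    f i + 0#                      ≡⟨ +-identityʳ (f i) ⟩
    f i                           ∎

  -‿distrib-sum : ∀ {n} (f : Fin n → A) → - sum f ≡ sum (λ i → - f i)
  -‿distrib-sum f = begin
    - sum f                       ≡⟨ -1*x≈-x (sum f) ⟨
    - 1# * sum f                  ≡⟨ *-distribˡ-sum (- 1#) f ⟩
    sum (λ i → - 1# * f i)        ≡⟨ sum-cong-≗ (λ i → -1*x≈-x (f i)) ⟩
    sum (λ i → - f i)             ∎

  sum-distrib-minus : ∀ {n} (f g : Fin n → A) → sum (λ i → f i - g i) ≡ sum f - sum g
  sum-distrib-minus f g = ≡.trans (∑-distrib-+ f (λ i → - g i)) (≡.cong (sum f +_) (≡.sym (-‿distrib-sum g)))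

  sum-lastZero : ∀ {m} (f : Fin (suc m) → A) → f (Fin.fromℕ m) ≡ 0# → sum f ≡ sum (f ∘ Fin.inject₁)
  sum-lastZero f f-last = ≡.trans (sum-init-last f) (≡.trans (≡.cong (sum (f ∘ Fin.inject₁) +_) f-last) (+-identityʳ _))

  Matrix : ℕ → ℕ → Set
  Matrix m n = Fin m → Fin n → A

  infix  4 _≈ᴹ_
  infixl 6 _+ᴹ_
  infixl 7 _*ᴹ_

  _≈ᴹ_ : ∀ {m n} → Matrix m n → Matrix m n → Set
  M ≈ᴹ N = ∀ i j → M i j ≡ N i j

  _+ᴹ_ : ∀ {m n} → Matrix m n → Matrix m n → Matrix m n
  (M +ᴹ N) i j = M i j + N i j

  -ᴹ_ : ∀ {m n} → Matrix m n → Matrix m n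
  (-ᴹ M) i j = - M i j

  0ᴹ : ∀ {m n} → Matrix m n
  0ᴹ i j = 0#

  _*ᴹ_ : ∀ {l m n} → Matrix l m → Matrix m n → Matrix l n
  (M *ᴹ N) i j = sum (λ k → M i k * N k j)

  1ᴹ : ∀ {n} → Matrix n n
  1ᴹ i j with i Fin.≟ j
  ... | yes _ = 1#
  ... | no  _ = 0#

  _ᵀ : ∀ {m n} → Matrix m n → Matrix n m
  (M ᵀ) i j = M j i

  1ᴹ-diag : ∀ {n} (i : Fin n) → 1ᴹ i i ≡ 1#
  1ᴹ-diag i with i Fin.≟ i
  ... | yes _   = ≡.refl
  ... | no  i≢i = contradiction ≡.refl i≢i

  1ᴹ-offdiag : ∀ {n} {i j : Fin n} → i ≢ j → 1ᴹ i j ≡ 0#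
  1ᴹ-offdiag {i = i} {j} i≢j with i Fin.≟ j
  ... | yes i≡j = contradiction i≡j i≢j
  ... | no  _   = ≡.refl

  *ᴹ-cong : ∀ {l m n} {M M′ : Matrix l m} {N N′ : Matrix m n} → M ≈ᴹ M′ → N ≈ᴹ N′ → M *ᴹ N ≈ᴹ M′ *ᴹ N′
  *ᴹ-cong M≈M′ N≈N′ i j = sum-cong-≗ (λ k → ≡.cong₂ _*_ (M≈M′ i k) (N≈N′ k j))

  *ᴹ-assoc : ∀ {k l m n} (L : Matrix k l) (M : Matrix l m) (N : Matrix m n) → (L *ᴹ M) *ᴹ N ≈ᴹ L *ᴹ (M *ᴹ N)
  *ᴹ-assoc L M N i j = begin
    sum (λ k → sum (λ l → L i l * M l k) * N k j)
      ≡⟨ sum-cong-≗ (λ k → *-distribʳ-sum (N k j) (λ l → L i l * M l k)) ⟩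
    sum (λ k → sum (λ l → L i l * M l k * N k j))
      ≡⟨ ∑-comm (λ k l → L i l * M l k * N k j) ⟩
    sum (λ l → sum (λ k → L i l * M l k * N k j))
      ≡⟨ sum-cong-≗ (λ l → sum-cong-≗ (λ k → *-assoc (L i l) (M l k) (N k j))) ⟩
    sum (λ l → sum (λ k → L i l * (M l k * N k j)))
      ≡⟨ sum-cong-≗ (λ l → *-distribˡ-sum (L i l) (λ k → M l k * N k j)) ⟨
    sum (λ l → L i l * sum (λ k → M l k * N k j))
      ∎

  *ᴹ-distribˡ : ∀ {l m n} (L : Matrix l m) (M N : Matrix m n) → L *ᴹ (M +ᴹ N) ≈ᴹ L *ᴹ M +ᴹ L *ᴹ N
  *ᴹ-distribˡ L M N i j =
    ≡.trans (sum-cong-≗ (λ k → distribˡ (L i k) _ _)) (∑-distrib-+ (λ k → L i k * M k j) (λ k → L i k * N k j))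

  *ᴹ-distribʳ : ∀ {l m n} (N : Matrix m n) (L M : Matrix l m) → (L +ᴹ M) *ᴹ N ≈ᴹ L *ᴹ N +ᴹ M *ᴹ N
  *ᴹ-distribʳ N L M i j =
    ≡.trans (sum-cong-≗ (λ k → distribʳ (N k j) _ _)) (∑-distrib-+ (λ k → L i k * N k j) (λ k → M i k * N k j))

  *ᴹ-identityˡ : ∀ {m n} (M : Matrix m n) → 1ᴹ *ᴹ M ≈ᴹ M
  *ᴹ-identityˡ M i j = begin
    sum (λ k → 1ᴹ i k * M k j) ≡⟨ sum-single _ i (λ k k≢i → ≡.trans (≡.cong (_* M k j) (1ᴹ-offdiag (k≢i ∘ ≡.sym)))
                                                                (zeroˡ _)) ⟩
    1ᴹ i i * M i j             ≡⟨ ≡.cong (_* M i j) (1ᴹ-diag i) ⟩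
    1# * M i j                 ≡⟨ *-identityˡ _ ⟩
    M i j                      ∎

  *ᴹ-identityʳ : ∀ {m n} (M : Matrix m n) → M *ᴹ 1ᴹ ≈ᴹ M
  *ᴹ-identityʳ M i j = begin
    sum (λ k → M i k * 1ᴹ k j) ≡⟨ sum-single _ j (λ k k≢j → ≡.trans (≡.cong (M i k *_) (1ᴹ-offdiag k≢j))
                                                                (zeroʳ _)) ⟩
    M i j * 1ᴹ j j             ≡⟨ ≡.cong (M i j *_) (1ᴹ-diag j) ⟩
    M i j * 1#                 ≡⟨ *-identityʳ _ ⟩
    M i j                      ∎

  ᵀ-*ᴹ : ∀ {l m n} (M : Matrix l m) (N : Matrix m n) → (M *ᴹ N) ᵀ ≈ᴹ N ᵀ *ᴹ M ᵀ
  ᵀ-*ᴹ M N i j = sum-cong-≗ (λ k → *-comm (M j k) (N k i))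

  1ᴹ-suc : ∀ {n} (i j : Fin n) → 1ᴹ (suc i) (suc j) ≡ 1ᴹ i j
  1ᴹ-suc i j with i Fin.≟ j
  ... | yes _ = ≡.refl
  ... | no  _ = ≡.refl

  1ᴹ-inject₁ : ∀ {n} (i j : Fin n) → 1ᴹ (Fin.inject₁ i) (Fin.inject₁ j) ≡ 1ᴹ i j
  1ᴹ-inject₁ i j with i Fin.≟ j
  ... | yes ≡.refl = 1ᴹ-diag (Fin.inject₁ i)
  ... | no  i≢j    = 1ᴹ-offdiag (i≢j ∘ Finₚ.inject₁-injective)

  ᵀ-1ᴹ : ∀ {n} → 1ᴹ {n} ᵀ ≈ᴹ 1ᴹ
  ᵀ-1ᴹ i j with i Fin.≟ j
  ... | yes ≡.refl = 1ᴹ-diag i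
  ... | no  i≢j    = 1ᴹ-offdiag (i≢j ∘ ≡.sym)

  matrixRing : ℕ → Ring 0ℓ 0ℓ
  matrixRing n = record
    { Carrier = Matrix n n
    ; _≈_     = _≈ᴹ_
    ; _+_     = _+ᴹ_
    ; _*_     = _*ᴹ_
    ; -_      = -ᴹ_
    ; 0#      = 0ᴹ
    ; 1#      = 1ᴹ
    ; isRing  = record
      { +-isAbelianGroup = Pointwise.isAbelianGroup (Fin n) (Pointwise.isAbelianGroup (Fin n) +-isAbelianGroup)
      ; *-cong           = *ᴹ-cong
      ; *-assoc          = *ᴹ-assoc
      ; *-identity       = *ᴹ-identityˡ , *ᴹ-identityʳ
      ; distrib          = *ᴹ-distribˡ , *ᴹ-distribʳ
      }
    }

  sum-assoc : ∀ {m n} (x : Fin m → A) (M : Matrix m n) (y : Fin n → A) →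
              sum (λ i → x i * sum (λ j → M i j * y j)) ≡ sum (λ j → sum (λ i → x i * M i j) * y j)
  sum-assoc x M y = ≡.sym (*ᴹ-assoc (λ (_ : Fin 1) → x) M (λ j (_ : Fin 1) → y j) zero zero)

  quadraticForm : ∀ {n} → Matrix n n → (Fin n → A) → A
  quadraticForm M x = sum (λ i → x i * sum (λ j → M i j * x j))

  quadraticForm-ᵀ : ∀ {n} (M : Matrix n n) x → quadraticForm (M ᵀ) x ≡ quadraticForm M x
  quadraticForm-ᵀ M x = ≡.trans (sum-assoc x (M ᵀ) x) (sum-cong-≗ (λ j →
    ≡.trans (*-comm _ (x j)) (≡.cong (x j *_) (sum-cong-≗ (λ i → *-comm (x i) (M j i))))))

  schur : ∀ {k} → Matrix (suc k) (suc k) → A → Matrix k k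
  schur M u i j = M (suc i) (suc j) - M (suc i) zero * u * M zero (suc j)

  RightInvertible : ∀ {n} → Matrix n n → Set
  RightInvertible M = ∃ λ W → M *ᴹ W ≈ᴹ 1ᴹ

  module _ {k} (M : Matrix (suc k) (suc k)) {u : A} (pivot : M zero zero * u ≡ 1#) where

    private
      a = M zero zero
      b = λ j → M zero (suc j)
      c = λ i → M (suc i) zero
      D = λ i j → M (suc i) (suc j)

      a*[u*t]≡t : ∀ t → a * (u * t) ≡ t
      a*[u*t]≡t t = ≡.trans (≡.sym (*-assoc a u t)) (≡.trans (≡.cong (_* t) pivot) (*-identityˡ t))

      a*-[u*t]+t≡0 : ∀ t → a * - (u * t) + t ≡ 0#
      a*-[u*t]+t≡0 t = begin
        a * - (u * t) + t   ≡⟨ ≡.cong (_+ t) (-‿distribʳ-* a (u * t)) ⟨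
        - (a * (u * t)) + t ≡⟨ ≡.cong (λ z → - z + t) (a*[u*t]≡t t) ⟩
        - t + t             ≡⟨ -‿inverseˡ t ⟩
        0#                  ∎

    -- The first coordinate x₀ = -u·(b·y) makes M (x₀ ∷ y) = 0 ∷ (schur M u) y.
    quadraticForm-schur : ∀ y → ∃ λ x₀ → quadraticForm M (x₀ ∷ y) ≡ quadraticForm (schur M u) y
    quadraticForm-schur y = x₀ , (begin
      x₀ * (a * x₀ + β) + sum (λ i → y i * (c i * x₀ + sum (λ j → D i j * y j)))
        ≡⟨ ≡.cong₂ _+_ (≡.trans (≡.cong (x₀ *_) (a*-[u*t]+t≡0 β)) (zeroʳ x₀))
                       (sum-cong-≗ (λ i → ≡.cong (y i *_) (row i))) ⟩
      0# + quadraticForm (schur M u) y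
        ≡⟨ +-identityˡ _ ⟩
      quadraticForm (schur M u) y ∎)
      where
      β = sum (λ j → b j * y j)
      x₀ = - (u * β)
      row : ∀ i → c i * x₀ + sum (λ j → D i j * y j) ≡ sum (λ j → schur M u i j * y j)
      row i = begin
        c i * - (u * β) + sum (λ j → D i j * y j)
          ≡⟨ solve 4 (λ c u β Σ → c :* :- (u :* β) :+ Σ := Σ :- c :* u :* β) ≡.refl (c i) u β _ ⟩
        sum (λ j → D i j * y j) - c i * u * β
          ≡⟨ ≡.cong (λ z → sum (λ j → D i j * y j) - z) (*-distribˡ-sum (c i * u) (λ j → b j * y j)) ⟩
        sum (λ j → D i j * y j) - sum (λ j → c i * u * (b j * y j))
          ≡⟨ sum-distrib-minus (λ j → D i j * y j) (λ j → c i * u * (b j * y j)) ⟨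
        sum (λ j → D i j * y j - c i * u * (b j * y j))
          ≡⟨ sum-cong-≗ (λ j → solve 5 (λ d c u b y → d :* y :- c :* u :* (b :* y) := (d :- c :* u :* b) :* y)
                                       ≡.refl (D i j) (c i) u (b j) (y j)) ⟩
        sum (λ j → schur M u i j * y j) ∎

    -- W is the block inverse formula for [a b; c D], where u and N invert a and D - c u b.
    rightInvertible-schur : RightInvertible (schur M u) → RightInvertible M
    rightInvertible-schur (N , SN≈1) = W , MW≈1
      where
      p = λ j → sum (λ l → b l * N l j)
      q = λ i → sum (λ l → N i l * c l)
      s = sum (λ j → p j * c j)

      W : Matrix (suc k) (suc k)
      W zero    zero    = u + u * s * u
      W zero    (suc j) = - (u * p j)
      W (suc i) zero    = - (q i * u)
      W (suc i) (suc j) = N i j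

      DN : ∀ i j → sum (λ l → D i l * N l j) ≡ 1ᴹ i j + c i * u * p j
      DN i j = begin
        sum (λ l → D i l * N l j)
          ≡⟨ sum-cong-≗ (λ l → solve 5 (λ d c u b n → d :* n := (d :- c :* u :* b) :* n :+ c :* u :* (b :* n))
                                       ≡.refl (D i l) (c i) u (b l) (N l j)) ⟩
        sum (λ l → schur M u i l * N l j + c i * u * (b l * N l j))
          ≡⟨ ∑-distrib-+ (λ l → schur M u i l * N l j) (λ l → c i * u * (b l * N l j)) ⟩
        (schur M u *ᴹ N) i j + sum (λ l → c i * u * (b l * N l j))
          ≡⟨ ≡.cong₂ _+_ (SN≈1 i j) (≡.sym (*-distribˡ-sum (c i * u) (λ l → b l * N l j))) ⟩
        1ᴹ i j + c i * u * p j ∎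

      Dq : ∀ i → sum (λ l → D i l * q l) ≡ c i + c i * u * s
      Dq i = begin
        sum (λ l → D i l * q l)
          ≡⟨ sum-assoc (D i) N c ⟩
        sum (λ j → sum (λ l → D i l * N l j) * c j)
          ≡⟨ sum-cong-≗ (λ j → ≡.cong (_* c j) (DN i j)) ⟩
        sum (λ j → (1ᴹ i j + c i * u * p j) * c j)
          ≡⟨ sum-cong-≗ (λ j → solve 5 (λ δ c u p cⱼ → (δ :+ c :* u :* p) :* cⱼ := δ :* cⱼ :+ c :* u :* (p :* cⱼ))
                                       ≡.refl (1ᴹ i j) (c i) u (p j) (c j)) ⟩
        sum (λ j → 1ᴹ i j * c j + c i * u * (p j * c j))
          ≡⟨ ∑-distrib-+ (λ j → 1ᴹ i j * c j) (λ j → c i * u * (p j * c j)) ⟩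
        (1ᴹ *ᴹ (λ j (_ : Fin 1) → c j)) i zero + sum (λ j → c i * u * (p j * c j))
          ≡⟨ ≡.cong₂ _+_ (*ᴹ-identityˡ (λ j (_ : Fin 1) → c j) i zero)
                         (≡.sym (*-distribˡ-sum (c i * u) (λ j → p j * c j))) ⟩
        c i + c i * u * s
          ∎

      ·-firstColumn : ∀ (r : Fin k → A) → sum (λ l → r l * W (suc l) zero) ≡ - (sum (λ l → r l * q l) * u)
      ·-firstColumn r = begin
        sum (λ l → r l * - (q l * u))
          ≡⟨ sum-cong-≗ (λ l → solve 3 (λ r q u → r :* :- (q :* u) := :- (r :* q :* u)) ≡.refl (r l) (q l) u) ⟩
        sum (λ l → - (r l * q l * u))
          ≡⟨ -‿distrib-sum (λ l → r l * q l * u) ⟨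
        - sum (λ l → r l * q l * u)
          ≡⟨ ≡.cong -_ (*-distribʳ-sum u (λ l → r l * q l)) ⟨
        - (sum (λ l → r l * q l) * u) ∎

      MW≈1 : M *ᴹ W ≈ᴹ 1ᴹ
      MW≈1 zero zero = begin
        a * (u + u * s * u) + sum (λ l → b l * W (suc l) zero)
          ≡⟨ ≡.cong (a * (u + u * s * u) +_) (≡.trans (·-firstColumn b) (≡.cong (λ z → - (z * u)) (sum-assoc b N c))) ⟩
        a * (u + u * s * u) - s * u
          ≡⟨ solve 3 (λ a u s → a :* (u :+ u :* s :* u) :- s :* u := a :* u :+ a :* (u :* (s :* u)) :- s :* u)
                     ≡.refl a u s ⟩
        a * u + a * (u * (s * u)) - s * u
          ≡⟨ ≡.cong₂ (λ x y → x + y - s * u) pivot (a*[u*t]≡t (s * u)) ⟩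
        1# + s * u - s * u
          ≡⟨ solve 2 (λ s u → :1 :+ s :* u :- s :* u := :1) ≡.refl s u ⟩
        1# ∎
      MW≈1 zero (suc j) = a*-[u*t]+t≡0 (p j)
      MW≈1 (suc i) zero = begin
        c i * (u + u * s * u) + sum (λ l → D i l * W (suc l) zero)
          ≡⟨ ≡.cong (c i * (u + u * s * u) +_) (≡.trans (·-firstColumn (D i)) (≡.cong (λ z → - (z * u)) (Dq i))) ⟩
        c i * (u + u * s * u) - (c i + c i * u * s) * u
          ≡⟨ solve 3 (λ c u s → c :* (u :+ u :* s :* u) :- (c :+ c :* u :* s) :* u := :0) ≡.refl (c i) u s ⟩
        0# ∎
      MW≈1 (suc i) (suc j) = begin
        c i * - (u * p j) + sum (λ l → D i l * N l j)
          ≡⟨ ≡.cong (c i * - (u * p j) +_) (DN i j) ⟩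
        c i * - (u * p j) + (1ᴹ i j + c i * u * p j)
          ≡⟨ solve 4 (λ c u p δ → c :* :- (u :* p) :+ (δ :+ c :* u :* p) := δ) ≡.refl (c i) u (p j) (1ᴹ i j) ⟩
        1ᴹ i j
          ≡⟨ 1ᴹ-suc i j ⟨
        1ᴹ (suc i) (suc j)
          ∎

  quadraticForm-init : ∀ {m} (M : Matrix (suc m) (suc m)) x → x (Fin.fromℕ m) ≡ 0# →
                       quadraticForm M x ≡ quadraticForm (λ i j → M (Fin.inject₁ i) (Fin.inject₁ j)) (x ∘ Fin.inject₁)
  quadraticForm-init {m} M x x-last = begin
    quadraticForm M x
      ≡⟨ sum-lastZero (λ i → x i * Mx i) (≡.trans (≡.cong (_* Mx (Fin.fromℕ m)) x-last) (zeroˡ _)) ⟩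
    sum (λ k → x (Fin.inject₁ k) * Mx (Fin.inject₁ k))
      ≡⟨ sum-cong-≗ (λ k → ≡.cong (x (Fin.inject₁ k) *_) (sum-lastZero (λ j → M (Fin.inject₁ k) j * x j)
                             (≡.trans (≡.cong (M (Fin.inject₁ k) (Fin.fromℕ m) *_) x-last) (zeroʳ _)))) ⟩
    quadraticForm (λ i j → M (Fin.inject₁ i) (Fin.inject₁ j)) (x ∘ Fin.inject₁)
      ∎
    where Mx = λ i → sum (λ j → M i j * x j)

  -- By the zero row sums Σⱼ Mᵢⱼ xⱼ = Σⱼ Mᵢⱼ (xⱼ - xᵢ); symmetrising in i, j
  -- then produces the squares.
  quadraticForm-zeroRowSums : ∀ {n} (M : Matrix n n) → (∀ i j → M i j ≡ M j i) → (∀ i → sum (M i) ≡ 0#) → ∀ x →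
    quadraticForm M x + quadraticForm M x ≡ sum (λ i → sum (λ j → - M i j * ((x i - x j) * (x i - x j))))
  quadraticForm-zeroRowSums M M-sym rowSum≡0 x = begin
    quadraticForm M x + quadraticForm M x
      ≡⟨ ≡.cong₂ _+_ half half′ ⟩
    sum (λ i → sum (T i)) + sum (λ i → sum (T′ i))
      ≡⟨ ≡.trans (sum-cong-≗ (λ i → ∑-distrib-+ (T i) (T′ i))) (∑-distrib-+ (λ i → sum (T i)) (λ i → sum (T′ i))) ⟨
    sum (λ i → sum (λ j → T i j + T′ i j))
      ≡⟨ sum-cong-≗ (λ i → sum-cong-≗ (λ j →
           solve 3 (λ xi xj m → xi :* (m :* (xj :- xi)) :+ xj :* (m :* (xi :- xj)) := :- m :* ((xi :- xj) :* (xi :- xj)))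
                   ≡.refl (x i) (x j) (M i j))) ⟩
    sum (λ i → sum (λ j → - M i j * ((x i - x j) * (x i - x j)))) ∎
    where
    row : ∀ i → sum (λ j → M i j * x j) ≡ sum (λ j → M i j * (x j - x i))
    row i = ≡.sym (begin
      sum (λ j → M i j * (x j - x i))            ≡⟨ sum-cong-≗ (λ j → x[y-z]≈xy-xz (M i j) (x j) (x i)) ⟩
      sum (λ j → M i j * x j - M i j * x i)      ≡⟨ sum-distrib-minus (λ j → M i j * x j) (λ j → M i j * x i) ⟩
      Mx - sum (λ j → M i j * x i)               ≡⟨ ≡.cong (λ t → Mx - t) (*-distribʳ-sum (x i) (M i)) ⟨
      Mx - sum (M i) * x i                       ≡⟨ ≡.cong (λ t → Mx - t * x i) (rowSum≡0 i) ⟩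
      Mx - 0# * x i                              ≡⟨ solve 2 (λ Mx xi → Mx :- :0 :* xi := Mx) ≡.refl Mx (x i) ⟩
      Mx                                         ∎)
      where Mx = sum (λ j → M i j * x j)
    T T′ : Matrix _ _
    T  i j = x i * (M i j * (x j - x i))
    T′ i j = x j * (M i j * (x i - x j))
    half : quadraticForm M x ≡ sum (λ i → sum (T i))
    half = sum-cong-≗ (λ i → ≡.trans (≡.cong (x i *_) (row i)) (*-distribˡ-sum (x i) (λ j → M i j * (x j - x i))))
    half′ : quadraticForm M x ≡ sum (λ i → sum (T′ i))
    half′ = ≡.trans half (≡.trans (∑-comm T) (sum-cong-≗ λ i → sum-cong-≗ λ j →
                                               ≡.cong (λ m → x j * (m * (x i - x j))) (M-sym j i)))

  quadraticForm-cong : ∀ {n} (M : Matrix n n) {x y : Fin n → A} → (∀ i → x i ≡ y i) → quadraticForm M x ≡ quadraticForm M y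
  quadraticForm-cong M x≗y = sum-cong-≗ (λ i → ≡.cong₂ _*_ (x≗y i) (sum-cong-≗ (λ j → ≡.cong (M i j *_) (x≗y j))))

  quadraticForm-basis : ∀ {n} (M : Matrix n n) i → quadraticForm M (1ᴹ i) ≡ M i i
  quadraticForm-basis M i = ≡.trans (sum-cong-≗ (λ k → ≡.cong (1ᴹ i k *_) Mₖeᵢ≡Mₖᵢ)) (*ᴹ-identityˡ M i i)
    where
    Mₖeᵢ≡Mₖᵢ : ∀ {k} → sum (λ j → M k j * 1ᴹ i j) ≡ M k i
    Mₖeᵢ≡Mₖᵢ {k} = ≡.trans (sum-cong-≗ (λ j → ≡.cong (M k j *_) (≡.sym (ᵀ-1ᴹ i j)))) (*ᴹ-identityʳ M k i)

  leftInverse≈rightInverse : ∀ {n} {M V W : Matrix n n} → V *ᴹ M ≈ᴹ 1ᴹ → M *ᴹ W ≈ᴹ 1ᴹ → V ≈ᴹ W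
  leftInverse≈rightInverse {n} {M} {V} {W} VM≈1 MW≈1 = trans (sym (elimʳ MW≈1 V)) (cancelˡ VM≈1 W)
    where
    open Ring (matrixRing n) using (*-monoid; sym; trans)
    open import Algebra.Properties.Monoid *-monoid using (elimʳ; cancelˡ)

  leftInverse-*-rowSums : ∀ {m n} {V : Matrix m n} {M : Matrix n m} → V *ᴹ M ≈ᴹ 1ᴹ →
                          ∀ i → sum (λ k → V i k * sum (M k)) ≡ 1#
  leftInverse-*-rowSums {V = V} {M} VM≈1 i = begin
    sum (λ k → V i k * sum (M k))
      ≡⟨ sum-cong-≗ (λ k → ≡.cong (V i k *_) (sum-cong-≗ (λ l → ≡.sym (*-identityʳ (M k l))))) ⟩
    sum (λ k → V i k * sum (λ l → M k l * 1#))
      ≡⟨ sum-assoc (V i) M (λ _ → 1#) ⟩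
    (V *ᴹ M *ᴹ 𝟏) i zero
      ≡⟨ *ᴹ-cong {N = 𝟏} VM≈1 (λ _ _ → ≡.refl) i zero ⟩
    (1ᴹ *ᴹ 𝟏) i zero
      ≡⟨ *ᴹ-identityˡ 𝟏 i zero ⟩
    1# ∎
    where
    𝟏 : Matrix _ 1
    𝟏 _ _ = 1#

  -- A right inverse of Mᵀ transposes to a left inverse of M, which must
  -- agree with the right inverse of M.
  rightInvertible-ᵀ⇒inverse : ∀ {n} {M : Matrix n n} → RightInvertible M → RightInvertible (M ᵀ) →
                              ∃ λ W → M *ᴹ W ≈ᴹ 1ᴹ × W *ᴹ M ≈ᴹ 1ᴹ
  rightInvertible-ᵀ⇒inverse {M = M} (W , MW≈1) (V , MᵀV≈1) = W , MW≈1 , WM≈1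
    where
    VᵀM≈1 : V ᵀ *ᴹ M ≈ᴹ 1ᴹ
    VᵀM≈1 i j = ≡.trans (≡.sym (ᵀ-*ᴹ (M ᵀ) V i j)) (≡.trans (MᵀV≈1 j i) (ᵀ-1ᴹ i j))
    WM≈1 : W *ᴹ M ≈ᴹ 1ᴹ
    WM≈1 i j = ≡.trans (*ᴹ-cong {N = M} W≈Vᵀ (λ _ _ → ≡.refl) i j) (VᵀM≈1 i j)
      where W≈Vᵀ = λ i k → ≡.sym (leftInverse≈rightInverse VᵀM≈1 MW≈1 i k)

module OneInverses {r ℓ} (R : Ring r ℓ) where

  open Ring R
  open import Relation.Binary.Reasoning.Setoid setoid

  -- The elements g, e, f play the roles of [L̃₁₁⁻¹ 0; 0 0], [0 𝟏; 0 1] and [0 0; 𝟏ᵀ 1].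
  module Splitting {a g e f : Carrier}
           (ae≈0 : a * e ≈ 0#) (fa≈0 : f * a ≈ 0#) (gf≈0 : g * f ≈ 0#)
           (ga+e≈1 : g * a + e ≈ 1#) (ag+f≈1 : a * g + f ≈ 1#) where

    aga≈a : a * g * a ≈ a
    aga≈a = begin
      a * g * a           ≈⟨ +-identityʳ _ ⟨
      a * g * a + 0#      ≈⟨ +-cong (sym (*-assoc a g a)) ae≈0 ⟨
      a * (g * a) + a * e ≈⟨ distribˡ a (g * a) e ⟨
      a * (g * a + e)     ≈⟨ *-congˡ ga+e≈1 ⟩
      a * 1#              ≈⟨ *-identityʳ a ⟩
      a                   ∎

    gag≈g : g * a * g ≈ g
    gag≈g = begin
      g * a * g           ≈⟨ +-identityʳ _ ⟨
      g * a * g + 0#      ≈⟨ +-cong (sym (*-assoc g a g)) gf≈0 ⟨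
      g * (a * g) + g * f ≈⟨ distribˡ g (a * g) f ⟨
      g * (a * g + f)     ≈⟨ *-congˡ ag+f≈1 ⟩
      g * 1#              ≈⟨ *-identityʳ g ⟩
      g                   ∎

    oneInverse⇔ : ∀ x → a * x * a ≈ a ⇔ ∃₂ λ y z → x ≈ g + e * y + z * f
    oneInverse⇔ x = mk⇔ (λ axa≈a → x , g * a * x , from axa≈a) (λ (y , z , x≈) → to y z x≈)
      where
      from : a * x * a ≈ a → x ≈ g + e * x + g * a * x * f
      from axa≈a = begin
        x                                  ≈⟨ *-identityˡ x ⟨
        1# * x                             ≈⟨ *-congʳ ga+e≈1 ⟨
        (g * a + e) * x                    ≈⟨ distribʳ x (g * a) e ⟩
        g * a * x + e * x                  ≈⟨ +-congʳ (*-identityʳ _) ⟨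
        g * a * x * 1# + e * x             ≈⟨ +-congʳ (*-congˡ ag+f≈1) ⟨
        g * a * x * (a * g + f) + e * x    ≈⟨ +-congʳ (distribˡ _ (a * g) f) ⟩
        g * a * x * (a * g) + g * a * x * f + e * x ≈⟨ +-congʳ (+-congʳ gaxag≈g) ⟩
        g + g * a * x * f + e * x          ≈⟨ +-assoc g _ _ ⟩
        g + (g * a * x * f + e * x)        ≈⟨ +-congˡ (+-comm _ _) ⟩
        g + (e * x + g * a * x * f)        ≈⟨ +-assoc g _ _ ⟨
        g + e * x + g * a * x * f          ∎
        where
        gaxag≈g : g * a * x * (a * g) ≈ g
        gaxag≈g = begin
          g * a * x * (a * g)   ≈⟨ *-assoc (g * a * x) a g ⟨
          g * a * x * a * g     ≈⟨ *-congʳ (*-congʳ (*-assoc g a x)) ⟩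
          g * (a * x) * a * g   ≈⟨ *-congʳ (*-assoc g (a * x) a) ⟩
          g * (a * x * a) * g   ≈⟨ *-congʳ (*-congˡ axa≈a) ⟩
          g * a * g             ≈⟨ gag≈g ⟩
          g                     ∎
      to : ∀ y z → x ≈ g + e * y + z * f → a * x * a ≈ a
      to y z x≈ = begin
        a * x * a                                 ≈⟨ *-congʳ (*-congˡ x≈) ⟩
        a * (g + e * y + z * f) * a               ≈⟨ sandwich-+ (g + e * y) (z * f) ⟩
        a * (g + e * y) * a + a * (z * f) * a     ≈⟨ +-congʳ (sandwich-+ g (e * y)) ⟩
        a * g * a + a * (e * y) * a + a * (z * f) * a ≈⟨ +-cong (+-cong aga≈a aeya≈0) azfa≈0 ⟩
        a + 0# + 0#                               ≈⟨ trans (+-identityʳ _) (+-identityʳ a) ⟩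
        a                                         ∎
        where
        sandwich-+ : ∀ p q → a * (p + q) * a ≈ a * p * a + a * q * a
        sandwich-+ p q = trans (*-congʳ (distribˡ a p q)) (distribʳ a (a * p) (a * q))
        aeya≈0 : a * (e * y) * a ≈ 0#
        aeya≈0 = begin
          a * (e * y) * a  ≈⟨ *-congʳ (*-assoc a e y) ⟨
          a * e * y * a    ≈⟨ *-congʳ (*-congʳ ae≈0) ⟩
          0# * y * a       ≈⟨ *-congʳ (zeroˡ y) ⟩
          0# * a           ≈⟨ zeroˡ a ⟩
          0#               ∎
        azfa≈0 : a * (z * f) * a ≈ 0#
        azfa≈0 = begin
          a * (z * f) * a  ≈⟨ *-congʳ (*-assoc a z f) ⟨
          a * z * f * a    ≈⟨ *-assoc (a * z) f a ⟩
          a * z * (f * a)  ≈⟨ *-congˡ fa≈0 ⟩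
          a * z * 0#       ≈⟨ zeroʳ _ ⟩
          0#               ∎

module DualNumbers (RF : RealField) where

  open RealField RF using (0r; 1r; _⁻¹; inverseʳ; isCommutativeRing)
  open Theory RF

  ℝ-commutativeRing : CommutativeRing 0ℓ 0ℓ
  ℝ-commutativeRing = record { isCommutativeRing = isCommutativeRing }

  open CommutativeRing ℝ-commutativeRing using (_+_; _*_; -_)

  open IntegerCoefficientSolver ℝ-commutativeRing using (solve; _:=_; _:+_; _:*_; _:-_; :-_; :0; :1)

  dual-≡ : ∀ {x y} → st x ≡ st y → du x ≡ du y → x ≡ y
  dual-≡ = ≡.cong₂ _+_ε

  𝔻-isCommutativeRing : IsCommutativeRing _≡_ _⊕_ _⊗_ ⊖_ 0d 1d
  𝔻-isCommutativeRing = record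
    { isRing = record
      { +-isAbelianGroup = record
        { isGroup = record
          { isMonoid = record
            { isSemigroup = record
              { isMagma = record { isEquivalence = ≡.isEquivalence ; ∙-cong = ≡.cong₂ _⊕_ }
              ; assoc = λ x y z → dual-≡ (+-assoc′ (st x) (st y) (st z)) (+-assoc′ (du x) (du y) (du z)) }
            ; identity = (λ x → dual-≡ (+-identityˡ′ (st x)) (+-identityˡ′ (du x)))
                       , (λ x → dual-≡ (+-identityʳ′ (st x)) (+-identityʳ′ (du x))) }
          ; inverse = (λ x → dual-≡ (-‿inverseˡ′ (st x)) (-‿inverseˡ′ (du x)))
                    , (λ x → dual-≡ (-‿inverseʳ′ (st x)) (-‿inverseʳ′ (du x)))
          ; ⁻¹-cong = ≡.cong ⊖_ }
        ; comm = λ x y → dual-≡ (+-comm′ (st x) (st y)) (+-comm′ (du x) (du y)) }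
      ; *-cong = ≡.cong₂ _⊗_
      ; *-assoc = λ (a + a′ ε) (b + b′ ε) (c + c′ ε) → dual-≡
          (solve 3 (λ a b c → (a :* b) :* c := a :* (b :* c)) ≡.refl a b c)
          (solve 6 (λ a a′ b b′ c c′ → (a :* b) :* c′ :+ (a :* b′ :+ a′ :* b) :* c
                                     := a :* (b :* c′ :+ b′ :* c) :+ a′ :* (b :* c)) ≡.refl a a′ b b′ c c′)
      ; *-identity = (λ (a + a′ ε) → dual-≡
                         (solve 1 (λ a → :1 :* a := a) ≡.refl a)
                         (solve 2 (λ a a′ → :1 :* a′ :+ :0 :* a := a′) ≡.refl a a′))
                   , (λ (a + a′ ε) → dual-≡
                         (solve 1 (λ a → a :* :1 := a) ≡.refl a)
                         (solve 2 (λ a a′ → a :* :0 :+ a′ :* :1 := a′) ≡.refl a a′))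
      ; distrib = (λ (a + a′ ε) (b + b′ ε) (c + c′ ε) → dual-≡
                     (solve 3 (λ a b c → a :* (b :+ c) := a :* b :+ a :* c) ≡.refl a b c)
                     (solve 6 (λ a a′ b b′ c c′ → a :* (b′ :+ c′) :+ a′ :* (b :+ c)
                                                := (a :* b′ :+ a′ :* b) :+ (a :* c′ :+ a′ :* c)) ≡.refl a a′ b b′ c c′))
                , (λ (a + a′ ε) (b + b′ ε) (c + c′ ε) → dual-≡
                     (solve 3 (λ a b c → (b :+ c) :* a := b :* a :+ c :* a) ≡.refl a b c)
                     (solve 6 (λ a a′ b b′ c c′ → (b :+ c) :* a′ :+ (b′ :+ c′) :* a
                                                := (b :* a′ :+ b′ :* a) :+ (c :* a′ :+ c′ :* a)) ≡.refl a a′ b b′ c c′))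
      }
    ; *-comm = λ (a + a′ ε) (b + b′ ε) → dual-≡
        (solve 2 (λ a b → a :* b := b :* a) ≡.refl a b)
        (solve 4 (λ a a′ b b′ → a :* b′ :+ a′ :* b := b :* a′ :+ b′ :* a) ≡.refl a a′ b b′)
    }
    where
    open IsCommutativeRing isCommutativeRing using ()
      renaming (+-assoc to +-assoc′; +-identityˡ to +-identityˡ′; +-identityʳ to +-identityʳ′;
                -‿inverseˡ to -‿inverseˡ′; -‿inverseʳ to -‿inverseʳ′; +-comm to +-comm′)

  st≢0⇒unit : ∀ x → st x ≢ 0r → ∃ λ u → x ⊗ u ≡ 1d
  st≢0⇒unit (s + d ε) s≢0 = (i + - (d * (i * i)) ε) , dual-≡ (inverseʳ s s≢0) du≡0
    where
    open ≡.≡-Reasoning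
    i = (s ⁻¹) s≢0
    du≡0 : s * - (d * (i * i)) + d * i ≡ 0r
    du≡0 = begin
      s * - (d * (i * i)) + d * i  ≡⟨ solve 3 (λ s d i → s :* :- (d :* (i :* i)) :+ d :* i := d :* i :* (:1 :- s :* i))
                                              ≡.refl s d i ⟩
      d * i * (1r + - (s * i))     ≡⟨ ≡.cong (λ t → d * i * (1r + - t)) (inverseʳ s s≢0) ⟩
      d * i * (1r + - 1r)          ≡⟨ solve 2 (λ d i → d :* i :* (:1 :- :1) := :0) ≡.refl d i ⟩
      0r                           ∎

module OrderedField (RF : RealField) where

  open RealField RF using (ℝ; 0r; 1r; _⁻¹; 0≢1; inverseʳ; isTotalOrder; +-mono-≤; *-nonneg; isCommutativeRing)
  open DualNumbers RF using (ℝ-commutativeRing)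
  open CommutativeRing ℝ-commutativeRing using (_+_; _*_; -_; _-_; +-comm; +-identityˡ; -‿inverseʳ; zeroˡ)
  open IsTotalOrder isTotalOrder using (total; antisym) renaming (trans to ≤-trans; refl to ≤-refl)
  open Matrices isCommutativeRing using (sum)
  open IntegerCoefficientSolver ℝ-commutativeRing using (solve; _:=_; _:*_; :-_; :1)
  open ≡.≡-Reasoning

  infix 4 _≤_
  _≤_ : ℝ → ℝ → Set
  _≤_ = RealField._≤_ RF

  +-nonneg : ∀ {x y} → 0r ≤ x → 0r ≤ y → 0r ≤ x + y
  +-nonneg {x} {y} 0≤x 0≤y = ≤-trans 0≤y (≡.subst (_≤ x + y) (+-identityˡ y) (+-mono-≤ y 0≤x))

  +-nonneg-zeroˡ : ∀ {x y} → 0r ≤ x → 0r ≤ y → x + y ≡ 0r → x ≡ 0r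
  +-nonneg-zeroˡ {x} {y} 0≤x 0≤y x+y≡0 =
    antisym (≡.subst₂ _≤_ (+-identityˡ x) (≡.trans (+-comm y x) x+y≡0) (+-mono-≤ x 0≤y)) 0≤x

  sum-nonneg : ∀ {n} (f : Fin n → ℝ) → (∀ i → 0r ≤ f i) → 0r ≤ sum f
  sum-nonneg {zero}  f 0≤f = ≤-refl
  sum-nonneg {suc n} f 0≤f = +-nonneg (0≤f zero) (sum-nonneg (f ∘ suc) (0≤f ∘ suc))

  sum-nonneg-zero : ∀ {n} (f : Fin n → ℝ) → (∀ i → 0r ≤ f i) → sum f ≡ 0r → ∀ i → f i ≡ 0r
  sum-nonneg-zero {suc n} f 0≤f Σ≡0 zero    = +-nonneg-zeroˡ (0≤f zero) (sum-nonneg (f ∘ suc) (0≤f ∘ suc)) Σ≡0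
  sum-nonneg-zero {suc n} f 0≤f Σ≡0 (suc i) = sum-nonneg-zero (f ∘ suc) (0≤f ∘ suc) Σ∘suc≡0 i
    where
    Σ∘suc≡0 = +-nonneg-zeroˡ (sum-nonneg (f ∘ suc) (0≤f ∘ suc)) (0≤f zero)
                             (≡.trans (+-comm (sum (f ∘ suc)) (f zero)) Σ≡0)

  square-nonneg : ∀ x → 0r ≤ x * x
  square-nonneg x with total 0r x
  ... | inj₁ 0≤x = *-nonneg 0≤x 0≤x
  ... | inj₂ x≤0 = ≡.subst (0r ≤_) (solve 1 (λ x → :- x :* :- x := x :* x) ≡.refl x) (*-nonneg 0≤-x 0≤-x)
    where
    0≤-x : 0r ≤ - x
    0≤-x = ≡.subst₂ _≤_ (-‿inverseʳ x) (+-identityˡ (- x)) (+-mono-≤ (- x) x≤0)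

  -- Equality on ℝ is undecidable, so only the double negation of x ≡ 0r follows.
  square-zero : ∀ x → x * x ≡ 0r → ¬ x ≢ 0r
  square-zero x x²≡0 x≢0 = 0≢1 (begin
    0r                    ≡⟨ zeroˡ (i * i) ⟨
    0r * (i * i)          ≡⟨ ≡.cong (_* (i * i)) x²≡0 ⟨
    x * x * (i * i)       ≡⟨ solve 2 (λ x i → x :* x :* (i :* i) := x :* i :* (x :* i)) ≡.refl x i ⟩
    x * i * (x * i)       ≡⟨ ≡.cong (λ t → t * t) (inverseʳ x x≢0) ⟩
    1r * 1r               ≡⟨ solve 0 (:1 :* :1 := :1) ≡.refl ⟩
    1r                    ∎)
    where i = (x ⁻¹) x≢0

module DualMatrices (RF : RealField) where

  open RealField RF using (0r; 0≢1; isCommutativeRing)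
  open Theory RF
  open DualNumbers RF
  module ℝᴹ = Matrices isCommutativeRing
  open Matrices 𝔻-isCommutativeRing public
  open CommutativeRing commutativeRing using (_+_; _*_; -_; +-identityˡ; +-identityʳ; -‿inverseˡ; *-identityʳ; zeroˡ; zeroʳ; ring)
  open import Algebra.Properties.Ring ring using (-‿distribʳ-*; +-inverseʳ-unique)
  open ≡.≡-Reasoning

  sumFin≡sum : ∀ {n} (f : Fin n → 𝔻) → sumFin f ≡ sum f
  sumFin≡sum {zero}  f = ≡.refl
  sumFin≡sum {suc n} f = ≡.cong (f zero ⊕_) (sumFin≡sum (f ∘ suc))

  ·≈*ᴹ : ∀ {l m n} (M : Mat l m) (N : Mat m n) → (M · N) ≈ (M *ᴹ N)
  ·≈*ᴹ M N i j = sumFin≡sum (λ k → M i k ⊗ N k j)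

  I≈1ᴹ : ∀ {n} → I {n} ≈ 1ᴹ
  I≈1ᴹ i j with i Fin.≟ j
  ... | yes _ = ≡.refl
  ... | no  _ = ≡.refl

  IsInverse⇔ : ∀ {n} (M W : Mat n n) → IsInverse M W ⇔ (M *ᴹ W ≈ᴹ 1ᴹ × W *ᴹ M ≈ᴹ 1ᴹ)
  IsInverse⇔ M W = mk⇔ (λ (MW≈I , WM≈I) → convert M W MW≈I , convert W M WM≈I)
                       (λ (MW≈1 , WM≈1) → revert M W MW≈1 , revert W M WM≈1)
    where
    convert : ∀ M W → (M · W) ≈ I → M *ᴹ W ≈ᴹ 1ᴹ
    convert M W MW≈I i j = ≡.trans (≡.sym (·≈*ᴹ M W i j)) (≡.trans (MW≈I i j) (I≈1ᴹ i j))
    revert : ∀ M W → M *ᴹ W ≈ᴹ 1ᴹ → (M · W) ≈ I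
    revert M W MW≈1 i j = ≡.trans (·≈*ᴹ M W i j) (≡.trans (MW≈1 i j) (≡.sym (I≈1ᴹ i j)))

  standardPart : ∀ {m n} → Mat m n → ℝᴹ.Matrix m n
  standardPart M i j = st (M i j)

  st-sum : ∀ {n} (f : Fin n → 𝔻) → st (sum f) ≡ ℝᴹ.sum (st ∘ f)
  st-sum {zero}  f = ≡.refl
  st-sum {suc n} f = ≡.cong (RealField._+_ RF (st (f zero))) (st-sum (f ∘ suc))

  Anisotropic : ∀ {n} → ℝᴹ.Matrix n n → Set
  Anisotropic M = ∀ x → (∃ λ i → x i ≢ 0r) → ℝᴹ.quadraticForm M x ≢ 0r

  -- Pivot on M₀₀: its standard part is the form at the first basis vector, so
  -- M₀₀ is a unit; the Schur complement's form is M's form on a hyperplane.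
  anisotropic⇒rightInvertible : ∀ {n} (M : Mat n n) → Anisotropic (standardPart M) → RightInvertible M
  anisotropic⇒rightInvertible {zero}  M _     = (λ ()) , (λ ())
  anisotropic⇒rightInvertible {suc n} M aniso =
    rightInvertible-schur M pivot (anisotropic⇒rightInvertible (schur M u) aniso-schur)
    where
    st-M₀₀≢0 : st (M zero zero) ≢ 0r
    st-M₀₀≢0 = aniso (ℝᴹ.1ᴹ zero) (zero , 0≢1 ∘ ≡.sym) ∘ ≡.trans (ℝᴹ.quadraticForm-basis (standardPart M) zero)
    u = proj₁ (st≢0⇒unit (M zero zero) st-M₀₀≢0)
    pivot = proj₂ (st≢0⇒unit (M zero zero) st-M₀₀≢0)
    aniso-schur : Anisotropic (standardPart (schur M u))
    aniso-schur y (i , yᵢ≢0) =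
      let x₀ , Q≡Qschur = ℝᴹ.quadraticForm-schur (standardPart M) (≡.cong st pivot) y
      in aniso (x₀ ∷ y) (suc i , yᵢ≢0) ∘ ≡.trans Q≡Qschur

  anisotropic⇒invertible : ∀ {n} (M : Mat n n) → Anisotropic (standardPart M) → Invertible M
  anisotropic⇒invertible M aniso =
    let W , inverse = rightInvertible-ᵀ⇒inverse (anisotropic⇒rightInvertible M aniso)
                                                (anisotropic⇒rightInvertible (M ᵀ) aniso-ᵀ)
    in W , Equivalence.from (IsInverse⇔ M W) inverse
    where
    aniso-ᵀ : Anisotropic (standardPart (M ᵀ))
    aniso-ᵀ x x≢0 = aniso x x≢0 ∘ ≡.trans (≡.sym (ℝᴹ.quadraticForm-ᵀ (standardPart M) x))

  view-inject₁ : ∀ {m} (k : Fin m) → view (Fin.inject₁ k) ≡ inj₁ k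
  view-inject₁ {suc m} zero    = ≡.refl
  view-inject₁ {suc m} (suc k) rewrite view-inject₁ k = ≡.refl

  view-fromℕ : ∀ m → view (Fin.fromℕ m) ≡ inj₂ tt
  view-fromℕ zero    = ≡.refl
  view-fromℕ (suc m) rewrite view-fromℕ m = ≡.refl

  module _ {m : ℕ} where

    padZero-inject₁ : ∀ (B : Mat m m) a b → padZero B (Fin.inject₁ a) (Fin.inject₁ b) ≡ B a b
    padZero-inject₁ B a b rewrite view-inject₁ a | view-inject₁ b = ≡.refl

    padZero-lastCol : ∀ (B : Mat m m) i → padZero B i (Fin.fromℕ m) ≡ 0d
    padZero-lastCol B i rewrite view-fromℕ m with view i
    ... | inj₁ _ = ≡.refl
    ... | inj₂ _ = ≡.refl

    padZero-lastRow : ∀ (B : Mat m m) j → padZero B (Fin.fromℕ m) j ≡ 0d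
    padZero-lastRow B j rewrite view-fromℕ m = ≡.refl

    lastColOnes-inject₁ : ∀ i k → lastColOnes {m} i (Fin.inject₁ k) ≡ 0d
    lastColOnes-inject₁ i k rewrite view-inject₁ k = ≡.refl

    lastColOnes-fromℕ : ∀ i → lastColOnes {m} i (Fin.fromℕ m) ≡ 1d
    lastColOnes-fromℕ i rewrite view-fromℕ m = ≡.refl

    lastRowOnes-inject₁ : ∀ k j → lastRowOnes {m} (Fin.inject₁ k) j ≡ 0d
    lastRowOnes-inject₁ k j rewrite view-inject₁ k = ≡.refl

    padZero-ᵀ : ∀ (B : Mat m m) → padZero B ᵀ ≈ᴹ padZero (B ᵀ)
    padZero-ᵀ B i j with view i | view j
    ... | inj₁ _ | inj₁ _ = ≡.refl
    ... | inj₁ _ | inj₂ _ = ≡.refl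
    ... | inj₂ _ | inj₁ _ = ≡.refl
    ... | inj₂ _ | inj₂ _ = ≡.refl

    lastColOnes-ᵀ : lastColOnes {m} ᵀ ≈ᴹ lastRowOnes
    lastColOnes-ᵀ i j with view i
    ... | inj₁ _ = ≡.refl
    ... | inj₂ _ = ≡.refl

    padZero-*ᴹ-inject₁ : ∀ (B : Mat m m) (N : Mat (suc m) (suc m)) a j →
                         (padZero B *ᴹ N) (Fin.inject₁ a) j ≡ sum (λ k → B a k * N (Fin.inject₁ k) j)
    padZero-*ᴹ-inject₁ B N a j = ≡.trans
      (sum-lastZero (λ k → padZero B (Fin.inject₁ a) k * N k j)
        (≡.trans (≡.cong (_* N (Fin.fromℕ m) j) (padZero-lastCol B (Fin.inject₁ a))) (zeroˡ (N (Fin.fromℕ m) j))))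
      (sum-cong-≗ (λ k → ≡.cong (_* N (Fin.inject₁ k) j) (padZero-inject₁ B a k)))

    padZero-*ᴹ-fromℕ : ∀ (B : Mat m m) (N : Mat (suc m) (suc m)) j → (padZero B *ᴹ N) (Fin.fromℕ m) j ≡ 0d
    padZero-*ᴹ-fromℕ B N j =
      sum-zero (λ k → padZero B (Fin.fromℕ m) k * N k j)
               (λ k → ≡.trans (≡.cong (_* N k j) (padZero-lastRow B k)) (zeroˡ (N k j)))

    padZero-*ᴹ-lastRowOnes : ∀ (B : Mat m m) → padZero B *ᴹ lastRowOnes ≈ᴹ 0ᴹ
    padZero-*ᴹ-lastRowOnes B i j = ≡.trans
      (sum-lastZero (λ k → padZero B i k * lastRowOnes k j)
        (≡.trans (≡.cong (_* lastRowOnes (Fin.fromℕ m) j) (padZero-lastCol B i)) (zeroˡ (lastRowOnes (Fin.fromℕ m) j))))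
      (sum-zero (λ k → padZero B i (Fin.inject₁ k) * lastRowOnes (Fin.inject₁ k) j)
        (λ k → ≡.trans (≡.cong (padZero B i (Fin.inject₁ k) *_) (lastRowOnes-inject₁ k j)) (zeroʳ _)))

    module _ (L : Mat (suc m) (suc m)) (rowSum≡0 : ∀ i → sum (L i) ≡ 0d) where

      *ᴹ-lastColOnes : L *ᴹ lastColOnes ≈ᴹ 0ᴹ
      *ᴹ-lastColOnes i j with view j
      ... | inj₁ _ = sum-zero (λ k → L i k * 0d) (λ k → zeroʳ (L i k))
      ... | inj₂ _ = ≡.trans (sum-cong-≗ (λ k → *-identityʳ (L i k))) (rowSum≡0 i)

      lastCol≡-rowSum : ∀ k → L (Fin.inject₁ k) (Fin.fromℕ m) ≡ - sum (λ l → block11 L k l)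
      lastCol≡-rowSum k = +-inverseʳ-unique (sum (block11 L k)) (L (Fin.inject₁ k) (Fin.fromℕ m))
        (≡.trans (≡.sym (sum-init-last (L (Fin.inject₁ k)))) (rowSum≡0 (Fin.inject₁ k)))

      -- The last column of L is -L̃₁₁ 𝟏, and B (L̃₁₁ 𝟏) = 𝟏.
      padZero-*ᴹ-+ᴹ-lastColOnes : ∀ B → B *ᴹ block11 L ≈ᴹ 1ᴹ → padZero B *ᴹ L +ᴹ lastColOnes ≈ᴹ 1ᴹ
      padZero-*ᴹ-+ᴹ-lastColOnes B BL≈1 i j with Top.view i | Top.view j
      ... | ‵fromℕ | ‵fromℕ =
        ≡.trans (≡.cong₂ _+_ (padZero-*ᴹ-fromℕ B L (Fin.fromℕ m)) (lastColOnes-fromℕ (Fin.fromℕ m)))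
                (≡.trans (+-identityˡ 1d) (≡.sym (1ᴹ-diag (Fin.fromℕ m))))
      ... | ‵fromℕ | ‵inject₁ b =
        ≡.trans (≡.cong₂ _+_ (padZero-*ᴹ-fromℕ B L (Fin.inject₁ b)) (lastColOnes-inject₁ (Fin.fromℕ m) b))
                (≡.trans (+-identityˡ 0d) (≡.sym (1ᴹ-offdiag {i = Fin.fromℕ m} {Fin.inject₁ b} Finₚ.fromℕ≢inject₁)))
      ... | ‵inject₁ a | ‵inject₁ b =
        ≡.trans (≡.cong₂ _+_ (≡.trans (padZero-*ᴹ-inject₁ B L a (Fin.inject₁ b)) (BL≈1 a b))
                             (lastColOnes-inject₁ (Fin.inject₁ a) b))
                (≡.trans (+-identityʳ (1ᴹ a b)) (≡.sym (1ᴹ-inject₁ a b)))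
      ... | ‵inject₁ a | ‵fromℕ = begin
        (padZero B *ᴹ L) (Fin.inject₁ a) (Fin.fromℕ m) + lastColOnes (Fin.inject₁ a) (Fin.fromℕ m)
          ≡⟨ ≡.cong₂ _+_ (padZero-*ᴹ-inject₁ B L a (Fin.fromℕ m)) (lastColOnes-fromℕ (Fin.inject₁ a)) ⟩
        sum (λ k → B a k * L (Fin.inject₁ k) (Fin.fromℕ m)) + 1d
          ≡⟨ ≡.cong (_+ 1d) (sum-cong-≗ (λ k → ≡.trans (≡.cong (B a k *_) (lastCol≡-rowSum k))
                                                        (≡.sym (-‿distribʳ-* (B a k) (sum (block11 L k)))))) ⟩
        sum (λ k → - (B a k * sum (block11 L k))) + 1d
          ≡⟨ ≡.cong (_+ 1d) (-‿distrib-sum (λ k → B a k * sum (block11 L k))) ⟨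
        - sum (λ k → B a k * sum (block11 L k)) + 1d
          ≡⟨ ≡.cong (λ t → - t + 1d) (leftInverse-*-rowSums {V = B} {block11 L} BL≈1 a) ⟩
        - 1d + 1d
          ≡⟨ -‿inverseˡ 1d ⟩
        0d
          ≡⟨ 1ᴹ-offdiag (Finₚ.fromℕ≢inject₁ ∘ ≡.sym) ⟨
        1ᴹ (Fin.inject₁ a) (Fin.fromℕ m) ∎

  IsOneInverse⇔ : ∀ {m n} (M : Mat m n) X → IsOneInverse M X ⇔ (M *ᴹ X *ᴹ M ≈ᴹ M)
  IsOneInverse⇔ M X = mk⇔ (λ MXM≈M i j → ≡.trans (≡.sym (·-·≈*ᴹ-*ᴹ i j)) (MXM≈M i j))
                          (λ MXM≈M i j → ≡.trans (·-·≈*ᴹ-*ᴹ i j) (MXM≈M i j))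
    where
    ·-·≈*ᴹ-*ᴹ : ((M · X) · M) ≈ (M *ᴹ X *ᴹ M)
    ·-·≈*ᴹ-*ᴹ i j = ≡.trans (·≈*ᴹ (M · X) M i j) (*ᴹ-cong {N = M} (·≈*ᴹ M X) (λ _ _ → ≡.refl) i j)

module DualLaplacian (RF : RealField) {m : ℕ} (G : Theory.Graph RF (suc m)) (a : Theory.EdgeData RF G) where

  open RealField RF using (ℝ; 0r; 1r; isTotalOrder; *-nonneg)
  open IsTotalOrder isTotalOrder using () renaming (refl to ≤-refl)
  open Theory RF
  open DualNumbers RF using (ℝ-commutativeRing)
  open DualMatrices RF
  open OrderedField RF
  open CommutativeRing commutativeRing using (_+_; _*_; -_; _-_; -‿inverseʳ; +-identityʳ)
  module ℝ = CommutativeRing ℝ-commutativeRing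
  open import Algebra.Properties.Ring ℝ.ring using (x∙y⁻¹≈ε⇒x≈y)
  open IntegerCoefficientSolver ℝ-commutativeRing using (solve; _:=_; _:*_; _:-_; :-_; :0)
  open ≡.≡-Reasoning

  L : Mat (suc m) (suc m)
  L = laplacian G a

  adjacency-sym : ∀ i j → adjacency G a i j ≡ adjacency G a j i
  adjacency-sym i j rewrite Adj-sym G i j | â-sym a i j = ≡.refl

  degree-offdiag : ∀ {i j} → i ≢ j → degree G a i j ≡ 0d
  degree-offdiag {i} {j} i≢j with i Fin.≟ j
  ... | yes i≡j = contradiction i≡j i≢j
  ... | no  _   = ≡.refl

  degree-diag : ∀ i → degree G a i i ≡ sumFin (adjacency G a i)
  degree-diag i with i Fin.≟ i
  ... | yes _   = ≡.refl
  ... | no  i≢i = contradiction ≡.refl i≢i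

  L-sym : ∀ i j → L i j ≡ L j i
  L-sym i j = by (i Fin.≟ j)
    where
    by : Dec (i ≡ j) → L i j ≡ L j i
    by (yes ≡.refl) = ≡.refl
    by (no i≢j)     = ≡.cong₂ _+_ (≡.trans (degree-offdiag i≢j) (≡.sym (degree-offdiag (i≢j ∘ ≡.sym))))
                                  (≡.cong -_ (adjacency-sym i j))

  L-rowSum : ∀ i → sum (L i) ≡ 0d
  L-rowSum i = begin
    sum (L i)
      ≡⟨ ∑-distrib-+ (degree G a i) (λ j → - adjacency G a i j) ⟩
    sum (degree G a i) + sum (λ j → - adjacency G a i j)
      ≡⟨ ≡.cong₂ _+_ degree-sum (≡.sym (-‿distrib-sum (adjacency G a i))) ⟩
    sum (adjacency G a i) - sum (adjacency G a i)
      ≡⟨ -‿inverseʳ _ ⟩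
    0d
      ∎
    where
    degree-sum : sum (degree G a i) ≡ sum (adjacency G a i)
    degree-sum = ≡.trans (sum-single (degree G a i) i (λ j j≢i → degree-offdiag (j≢i ∘ ≡.sym)))
                         (≡.trans (degree-diag i) (sumFin≡sum (adjacency G a i)))

  L-colSum : ∀ j → sum (λ i → L i j) ≡ 0d
  L-colSum j = ≡.trans (sum-cong-≗ (λ i → L-sym i j)) (L-rowSum j)

  Lˢ : ℝᴹ.Matrix (suc m) (suc m)
  Lˢ = standardPart L

  -Lˢ-offdiag : ∀ {i j} → i ≢ j → ℝ.- Lˢ i j ≡ st (adjacency G a i j)
  -Lˢ-offdiag {i} {j} i≢j rewrite degree-offdiag i≢j =
    solve 1 (λ w → :- (:0 :- w) := w) ≡.refl (st (adjacency G a i j))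

  st-adjacency-nonneg : ∀ i j → 0r ≤ st (adjacency G a i j)
  st-adjacency-nonneg i j with Adj G i j
  ... | true  = ≡.subst (0r ≤_) (ℝ.*-identityˡ 1r) (square-nonneg 1r)
  ... | false = ≤-refl

  st-adjacency-edge : ∀ {i j} → Adj G i j ≡ true → st (adjacency G a i j) ≡ 1r
  st-adjacency-edge {i} {j} edge rewrite edge = ≡.refl

  edgeTerm : (Fin (suc m) → ℝ) → Fin (suc m) → Fin (suc m) → ℝ
  edgeTerm z i j = ℝ.- Lˢ i j ℝ.* ((z i ℝ.- z j) ℝ.* (z i ℝ.- z j))

  edgeTerm-nonneg : ∀ z i j → 0r ≤ edgeTerm z i j
  edgeTerm-nonneg z i j = by (i Fin.≟ j)
    where
    by : Dec (i ≡ j) → 0r ≤ edgeTerm z i j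
    by (yes ≡.refl) = ≡.subst (0r ≤_) (≡.sym (solve 2 (λ l x → :- l :* ((x :- x) :* (x :- x)) := :0) ≡.refl (Lˢ i i) (z i)))
                              ≤-refl
    by (no i≢j)     = ≡.subst (λ w → 0r ≤ w ℝ.* _) (≡.sym (-Lˢ-offdiag i≢j))
                              (*-nonneg (st-adjacency-nonneg i j) (square-nonneg (z i ℝ.- z j)))

  edge⇒¬≢ : ∀ z {i j} → Adj G i j ≡ true → edgeTerm z i j ≡ 0r → ¬ z i ≢ z j
  edge⇒¬≢ z {i} {j} edge term≡0 zᵢ≢zⱼ =
    square-zero (z i ℝ.- z j) square≡0 (zᵢ≢zⱼ ∘ x∙y⁻¹≈ε⇒x≈y (z i) (z j))
    where
    i≢j : i ≢ j
    i≢j ≡.refl = contradiction (≡.trans (≡.sym edge) (Adj-irr G i)) λ ()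
    square≡0 : (z i ℝ.- z j) ℝ.* (z i ℝ.- z j) ≡ 0r
    square≡0 = ≡.trans (≡.sym (ℝ.*-identityˡ _))
                       (≡.trans (≡.cong (ℝ._* _) (≡.sym (≡.trans (-Lˢ-offdiag i≢j) (st-adjacency-edge edge)))) term≡0)

  reachable⇒¬≢ : ∀ z → (∀ i j → edgeTerm z i j ≡ 0r) → ∀ {i k} → Reachable G i k → ¬ z i ≢ z k
  reachable⇒¬≢ z terms≡0 here               zᵢ≢zₖ = zᵢ≢zₖ ≡.refl
  reachable⇒¬≢ z terms≡0 (step {i} {j} e r) zᵢ≢zₖ =
    edge⇒¬≢ z e (terms≡0 i j) (λ zᵢ≡zⱼ → reachable⇒¬≢ z terms≡0 r (zᵢ≢zₖ ∘ ≡.trans zᵢ≡zⱼ))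

  extendByZero : (Fin m → ℝ) → Fin (suc m) → ℝ
  extendByZero x i = [ x , (λ _ → 0r) ]′ (view i)

  -- A nonzero x with xᵀ L̃₁₁ x = 0 extends by 0 to z with zᵀ L z = 0, so z is
  -- constant along edges, hence (G being connected) equal to its last entry 0.
  connected⇒anisotropic : Connected G → Anisotropic (standardPart (block11 L))
  connected⇒anisotropic connected x (i₀ , xᵢ₀≢0) Q≡0 =
    reachable⇒¬≢ z terms≡0 (connected (Fin.inject₁ i₀) (Fin.fromℕ m))
                 (λ e → xᵢ₀≢0 (≡.trans (≡.sym (z-inject₁ i₀)) (≡.trans e z-last)))
    where
    z = extendByZero x
    z-inject₁ : ∀ k → z (Fin.inject₁ k) ≡ x k
    z-inject₁ k = ≡.cong [ x , (λ _ → 0r) ]′ (view-inject₁ k)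
    z-last : z (Fin.fromℕ m) ≡ 0r
    z-last = ≡.cong [ x , (λ _ → 0r) ]′ (view-fromℕ m)
    Qz≡0 : ℝᴹ.quadraticForm Lˢ z ≡ 0r
    Qz≡0 = ≡.trans (ℝᴹ.quadraticForm-init Lˢ z z-last) (≡.trans (ℝᴹ.quadraticForm-cong _ z-inject₁) Q≡0)
    Σterms≡0 : ℝᴹ.sum (λ i → ℝᴹ.sum (edgeTerm z i)) ≡ 0r
    Σterms≡0 = ≡.trans (≡.sym (ℝᴹ.quadraticForm-zeroRowSums Lˢ (λ i j → ≡.cong st (L-sym i j))
                                                            (λ i → ≡.trans (≡.sym (st-sum (L i))) (≡.cong st (L-rowSum i))) z))
                       (≡.trans (≡.cong₂ ℝ._+_ Qz≡0 Qz≡0) (ℝ.+-identityʳ 0r))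
    terms≡0 : ∀ i j → edgeTerm z i j ≡ 0r
    terms≡0 i = sum-nonneg-zero (edgeTerm z i) (edgeTerm-nonneg z i)
                  (sum-nonneg-zero _ (λ i → sum-nonneg _ (edgeTerm-nonneg z i)) Σterms≡0 i)

  leadingBlock-invertible : Connected G → Invertible (block11 L)
  leadingBlock-invertible = anisotropic⇒invertible (block11 L) ∘ connected⇒anisotropic

  module _ (B : Mat m m) (B-inverse : IsInverse (block11 L) B) where

    private
      L̃₁₁B≈1 : block11 L *ᴹ B ≈ᴹ 1ᴹ
      L̃₁₁B≈1 = proj₁ (Equivalence.to (IsInverse⇔ (block11 L) B) B-inverse)

      BL̃₁₁≈1 : B *ᴹ block11 L ≈ᴹ 1ᴹ
      BL̃₁₁≈1 = proj₂ (Equivalence.to (IsInverse⇔ (block11 L) B) B-inverse)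

    lastRowOnes-*ᴹ : lastRowOnes *ᴹ L ≈ᴹ 0ᴹ
    lastRowOnes-*ᴹ i j = begin
      (lastRowOnes *ᴹ L) i j        ≡⟨ ᵀ-*ᴹ lastRowOnes L j i ⟩
      (L ᵀ *ᴹ lastRowOnes ᵀ) j i    ≡⟨ *ᴹ-cong {M = L ᵀ} (λ _ _ → ≡.refl) (λ k l → ≡.sym (lastColOnes-ᵀ l k)) j i ⟩
      (L ᵀ *ᴹ lastColOnes) j i      ≡⟨ *ᴹ-lastColOnes (L ᵀ) L-colSum j i ⟩
      0d                            ∎

    -- The transpose of padZero-*ᴹ-+ᴹ-lastColOnes for Lᵀ and Bᵀ.
    *ᴹ-padZero-+ᴹ-lastRowOnes : L *ᴹ padZero B +ᴹ lastRowOnes ≈ᴹ 1ᴹ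
    *ᴹ-padZero-+ᴹ-lastRowOnes i j = begin
      (L *ᴹ padZero B) i j + lastRowOnes i j
        ≡⟨ ≡.cong₂ _+_ (ᵀ-*ᴹ L (padZero B) j i) (≡.sym (lastColOnes-ᵀ i j)) ⟩
      (padZero B ᵀ *ᴹ L ᵀ) j i + lastColOnes j i
        ≡⟨ ≡.cong (_+ lastColOnes j i) (*ᴹ-cong {N = L ᵀ} (padZero-ᵀ B) (λ _ _ → ≡.refl) j i) ⟩
      (padZero (B ᵀ) *ᴹ L ᵀ) j i + lastColOnes j i
        ≡⟨ padZero-*ᴹ-+ᴹ-lastColOnes (L ᵀ) L-colSum (B ᵀ) BᵀL̃₁₁ᵀ≈1 j i ⟩
      1ᴹ j i
        ≡⟨ ᵀ-1ᴹ i j ⟩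
      1ᴹ i j ∎
      where
      BᵀL̃₁₁ᵀ≈1 : B ᵀ *ᴹ block11 L ᵀ ≈ᴹ 1ᴹ
      BᵀL̃₁₁ᵀ≈1 a b = ≡.trans (≡.sym (ᵀ-*ᴹ (block11 L) B a b)) (≡.trans (L̃₁₁B≈1 b a) (ᵀ-1ᴹ a b))

    open OneInverses.Splitting (matrixRing (suc m)) {L} {padZero B} {lastColOnes} {lastRowOnes}
      (*ᴹ-lastColOnes L L-rowSum) lastRowOnes-*ᴹ (padZero-*ᴹ-lastRowOnes B)
      (padZero-*ᴹ-+ᴹ-lastColOnes L L-rowSum B BL̃₁₁≈1) *ᴹ-padZero-+ᴹ-lastRowOnes

    padZero-oneInverse : IsOneInverse L (padZero B)
    padZero-oneInverse = Equivalence.from (IsOneInverse⇔ L (padZero B)) aga≈a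

    oneInverses : ∀ X → IsOneInverse L X ⇔ (∃[ P ] ∃[ Q ] (X ≈ ((padZero B ⊞ (lastColOnes · P)) ⊞ (Q · lastRowOnes))))
    oneInverses X = mk⇔
      (λ LXL≈L → let P , Q , X≈ = to (oneInverse⇔ X) (to (IsOneInverse⇔ L X) LXL≈L)
                 in P , Q , λ i j → ≡.trans (X≈ i j) (≡.sym (split≈ P Q i j)))
      (λ (P , Q , X≈) → from (IsOneInverse⇔ L X) (from (oneInverse⇔ X) (P , Q , λ i j → ≡.trans (X≈ i j) (split≈ P Q i j))))
      where
      open Equivalence using (to; from)
      split≈ : ∀ P Q → ((padZero B ⊞ (lastColOnes · P)) ⊞ (Q · lastRowOnes)) ≈ (padZero B +ᴹ lastColOnes *ᴹ P +ᴹ Q *ᴹ lastRowOnes)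
      split≈ P Q i j = ≡.cong₂ _+_ (≡.cong (padZero B i j +_) (·≈*ᴹ lastColOnes P i j)) (·≈*ᴹ Q lastRowOnes i j)

theorem3p2 : (RF : RealField) → let open Theory RF in
    (m : ℕ) (G : Graph (suc m)) (a : EdgeData G) → Connected G →
    let L = laplacian G a in
      Invertible (block11 L)
      × (∀ B → IsInverse (block11 L) B →
           IsOneInverse L (padZero B)
           × (∀ X → IsOneInverse L X ⇔
                (∃[ P ] ∃[ Q ] (X ≈ ((padZero B ⊞ (lastColOnes · P)) ⊞ (Q · lastRowOnes))))))
theorem3p2 RF m G a connected =
  leadingBlock-invertible connected , λ B B-inverse → padZero-oneInverse B B-inverse , oneInverses B B-inverse
  where open DualLaplacian RF G a
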